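{- There exists a function $G:\mathbb{Z}_{\ge0}\to\mathbb{Z}_{\ge0}$ such that for all non-negative integers $n\ge k$, multiset-reconstructibility holds for $(n,k)$ if and only if $k\le G(n)$.
   Context: For partitions $\mu,\lambda$ write $\mu\le\lambda$ if $\mu_i\le\lambda_i$ for all $i$. For $\lambda\vdash n$ and $0\le k\le n$, a $k$-minor of $\lambda$ is a partition $\mu\vdash n-k$ with $\mu\le\lambda$. $N(\lambda/\mu)$ is the number of standard Young tableaux of skew shape $\lambda/\mu$. $\widehat{M}_k(\lambda)$ is the multiset of $k$-minors $\mu$ of $\lambda$ with multiplicity $N(\lambda/\mu)$. Multiset-reconstructibility holds for $(n,k)$ if for all partitions $\mu,\nu$ of $n$, $\widehat{M}_k(\mu)=\widehat{M}_k(\nu)$ implies $\mu=\nu$. -}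

module Defs where

open import Data.Nat using (ℕ; zero; suc; _+_; _∸_; _≤_; _<_; _<ᵇ_; _≤ᵇ_; _≟_; pred)
open import Data.Bool using (Bool; true; false; if_then_else_; _∧_)
open import Data.List using (List; []; _∷_; _++_; map)
open import Data.Nat.ListAction using (sum)
open import Data.List.Properties using (≡-dec)
open import Data.List.Relation.Unary.All using (All)
open import Data.List.Relation.Unary.Linked using (Linked)
open import Data.Product using (_×_)
open import Relation.Binary.PropositionalEquality using (_≡_)
open import Relation.Nullary.Decidable using (does)

IsPartition : ℕ → List ℕ → Set
IsPartition n l = Linked (λ a b → b ≤ a) l × All (λ a → 0 < a) l × sum l ≡ n

leq : List ℕ → List ℕ → Bool
leq [] _ = true
leq (x ∷ xs) [] = (x ≤ᵇ 0) ∧ leq xs []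
leq (x ∷ xs) (y ∷ ys) = (x ≤ᵇ y) ∧ leq xs ys

head0 : List ℕ → ℕ
head0 [] = 0
head0 (x ∷ _) = x

cons+ : ℕ → List ℕ → List ℕ
cons+ zero xs = xs
cons+ (suc x) xs = suc x ∷ xs

-- all partitions obtained from a partition by removing one corner cell
removals : List ℕ → List (List ℕ)
removals [] = []
removals (x ∷ xs) =
  (if head0 xs <ᵇ x then cons+ (pred x) xs ∷ [] else []) ++ map (x ∷_) (removals xs)

-- number of saturated chains of length d in Young's lattice from μ up to λ
chains : ℕ → List ℕ → List ℕ → ℕ
chains zero lam mu = if does (≡-dec _≟_ lam mu) then 1 else 0
chains (suc d) lam mu = sum (map (λ lam' → chains d lam' mu) (removals lam))

-- N(λ/μ): number of standard Young tableaux of skew shape λ/μ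
-- (= number of saturated chains μ = λ⁰ ⋖ λ¹ ⋖ … ⋖ λ^(|λ|-|μ|) = λ).
N : List ℕ → List ℕ → ℕ
N lam mu = chains (sum lam ∸ sum mu) lam mu

-- multiplicity of μ in the multiset of k-minors of λ (μ assumed a partition of n-k)
multMinor : List ℕ → List ℕ → ℕ
multMinor lam mu = if leq mu lam then N lam mu else 0

MultisetReconstructible : ℕ → ℕ → Set
MultisetReconstructible n k =
  ∀ (μ ν : List ℕ) → IsPartition n μ → IsPartition n ν →
  (∀ (ρ : List ℕ) → IsPartition (n ∸ k) ρ → multMinor μ ρ ≡ multMinor ν ρ) →
  μ ≡ ν

-- N(λ/ρ) counts the saturated chains from ρ up to λ in Young's lattice. Splitting off the
-- lowest step of each chain instead of the highest one gives, for |ρ| < |λ|,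
--   N(λ/ρ) = Σ { N(λ/σ) | σ is ρ plus one cell },
-- and since N(λ/σ) = 0 unless σ ⊆ λ, the minor multiplicities satisfy the same identity.
-- So the (k+1)-minors of λ are determined by its k-minors, and reconstructibility for
-- (n, k+1) implies it for (n, k); for k = 0 it holds because λ is its only 0-minor.
-- Being decidable (only finitely many partitions are involved) and downward closed in k,
-- reconstructibility holds exactly for the k up to a threshold G(n).
module Submission where

open import Data.Nat.Properties
open import Algebra.Properties.CommutativeSemigroup +-commutativeSemigroup using (interchange)
open import Data.Bool using (true; false; if_then_else_; _∧_; T)
open import Data.Bool.Properties using (T-∧)
open import Data.List using (List; []; _∷_; _++_; map; length)
open import Data.List.Properties using (≡-dec; map-++; map-∘; map-cong; ∷-injectiveˡ; ∷-injectiveʳ)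
open import Data.List.Relation.Unary.All using (All; []; _∷_; all?; zip) renaming (map to All-map)
open import Data.List.Relation.Unary.All.Properties using (++⁺; map⁺)
open import Data.List.Relation.Unary.Linked using (Linked; []; [-]; _∷_; linked?)
open import Data.Nat using (ℕ; zero; suc; _+_; _∸_; _≤_; _<_; _<ᵇ_; _≤ᵇ_; _≟_; _≤?_; _<?_; pred; z≤n; s≤s)
open import Data.Nat.ListAction using (sum)
open import Data.Nat.ListAction.Properties using (sum-++)
open import Data.Product using (Σ; _×_; _,_; proj₁; proj₂)
open import Data.Sum using (_⊎_; inj₁; inj₂)
open import Function using (_∘_)
open import Function.Bundles using (_⇔_; mk⇔; Equivalence)
open import Relation.Binary.PropositionalEquality
open import Relation.Nullary using (¬_; Dec; yes; no; contradiction)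
open import Relation.Nullary.Decidable using (does; dec-true; dec-false; map′; _×-dec_; _→-dec_)
open import Relation.Unary using (Pred; Decidable)
open import Level using (0ℓ)
open import Defs

open Equivalence using (to; from)

∑ : {A : Set} → List A → (A → ℕ) → ℕ
∑ xs f = sum (map f xs)

syntax ∑ xs (λ x → e) = ∑[ x ∈ xs ] e

module _ {A : Set} where

  ∑-++ : ∀ (xs ys : List A) f → ∑ (xs ++ ys) f ≡ ∑ xs f + ∑ ys f
  ∑-++ xs ys f = trans (cong sum (map-++ f xs ys)) (sum-++ (map f xs) (map f ys))

  ∑-map : ∀ {B : Set} (g : B → A) xs f → ∑ (map g xs) f ≡ ∑ xs (f ∘ g)
  ∑-map g xs f = cong sum (sym (map-∘ xs))

  ∑-cong : ∀ {P : Pred A 0ℓ} {xs} {f g : A → ℕ} →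
           All P xs → (∀ {x} → P x → f x ≡ g x) → ∑ xs f ≡ ∑ xs g
  ∑-cong []         f≡g = refl
  ∑-cong (px ∷ pxs) f≡g = cong₂ _+_ (f≡g px) (∑-cong pxs f≡g)

  ∑-cong≗ : ∀ {f g : A → ℕ} → (∀ x → f x ≡ g x) → ∀ xs → ∑ xs f ≡ ∑ xs g
  ∑-cong≗ f≗g xs = cong sum (map-cong f≗g xs)

  ∑-zero : ∀ (xs : List A) → ∑[ x ∈ xs ] 0 ≡ 0
  ∑-zero []       = refl
  ∑-zero (_ ∷ xs) = ∑-zero xs

  ∑-zero≗ : ∀ {f : A → ℕ} → (∀ x → f x ≡ 0) → ∀ xs → ∑ xs f ≡ 0
  ∑-zero≗ f≗0 xs = trans (∑-cong≗ f≗0 xs) (∑-zero xs)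

  ∑-+ : ∀ xs (f g : A → ℕ) → ∑[ x ∈ xs ] (f x + g x) ≡ ∑ xs f + ∑ xs g
  ∑-+ []       f g = refl
  ∑-+ (x ∷ xs) f g = trans (cong (f x + g x +_) (∑-+ xs f g)) (interchange (f x) (g x) _ _)

  ∑-if : ∀ {m} c (x : A) f → (T c → f x ≡ m) → (¬ T c → m ≡ 0) →
         ∑ (if c then x ∷ [] else []) f ≡ m
  ∑-if true  x f hit _    = trans (+-identityʳ (f x)) (hit _)
  ∑-if false x f _   miss = sym (miss λ ())

  All-if : ∀ {P : Pred A 0ℓ} c x → (T c → P x) → All P (if c then x ∷ [] else [])
  All-if true  x Px = Px _ ∷ []
  All-if false x _  = []

∑-swap : ∀ {A B : Set} (xs : List A) (ys : List B) (f : A → B → ℕ) →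
         ∑[ x ∈ xs ] ∑[ y ∈ ys ] f x y ≡ ∑[ y ∈ ys ] ∑[ x ∈ xs ] f x y
∑-swap []       ys f = sym (∑-zero ys)
∑-swap (x ∷ xs) ys f =
  trans (cong (∑ ys (f x) +_) (∑-swap xs ys f)) (sym (∑-+ ys (f x) (λ y → ∑[ x ∈ xs ] f x y)))

δ : List ℕ → List ℕ → ℕ
δ a b = if does (≡-dec _≟_ a b) then 1 else 0

δ-≡ : ∀ {a b} → a ≡ b → δ a b ≡ 1
δ-≡ {a} {b} a≡b = cong (if_then 1 else 0) (dec-true (≡-dec _≟_ a b) a≡b)

δ-≢ : ∀ {a b} → ¬ a ≡ b → δ a b ≡ 0
δ-≢ {a} {b} a≢b = cong (if_then 1 else 0) (dec-false (≡-dec _≟_ a b) a≢b)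

δ-≡1 : ∀ {a b} → δ a b ≡ 1 → a ≡ b
δ-≡1 {a} {b} δ≡1 with ≡-dec _≟_ a b
... | yes a≡b = a≡b
... | no _    = contradiction δ≡1 0≢1+n

δ-cong : ∀ {a b c d} → (a ≡ b → c ≡ d) → (c ≡ d → a ≡ b) → δ a b ≡ δ c d
δ-cong {a} {b} ab⇒cd cd⇒ab with ≡-dec _≟_ a b
... | yes a≡b = sym (δ-≡ (ab⇒cd a≡b))
... | no a≢b  = sym (δ-≢ (a≢b ∘ cd⇒ab))

δ-∷ : ∀ x a b → δ (x ∷ a) (x ∷ b) ≡ δ a b
δ-∷ x a b = δ-cong {x ∷ a} {x ∷ b} ∷-injectiveʳ (cong (x ∷_))

data Partition : List ℕ → Set where
  []   : Partition []
  cons : ∀ {x xs} → 0 < x → head0 xs ≤ x → Partition xs → Partition (x ∷ xs)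

isPartition⇒Partition : ∀ {n l} → IsPartition n l → Partition l
isPartition⇒Partition (decreasing , positive , _) = go decreasing positive
  where
  go : ∀ {l} → Linked (λ a b → b ≤ a) l → All (0 <_) l → Partition l
  go []          []          = []
  go [-]         (0<x ∷ [])  = cons 0<x z≤n []
  go (y≤x ∷ dec) (0<x ∷ pos) = cons 0<x y≤x (go dec pos)

Partition⇒IsPartition : ∀ {l} → Partition l → IsPartition (sum l) l
Partition⇒IsPartition p = decreasing p , positive p , refl
  where
  decreasing : ∀ {l} → Partition l → Linked (λ a b → b ≤ a) l
  decreasing []                          = []
  decreasing (cons _ _ [])               = [-]
  decreasing (cons _ y≤x p@(cons _ _ _)) = y≤x ∷ decreasing p
  positive : ∀ {l} → Partition l → All (0 <_) l
  positive []             = []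
  positive (cons 0<x _ p) = 0<x ∷ positive p

head0<1⇒[] : ∀ {xs} → Partition xs → head0 xs < 1 → xs ≡ []
head0<1⇒[] []             _         = refl
head0<1⇒[] (cons 0<y _ _) (s≤s y≤0) = contradiction (≤-trans 0<y y≤0) λ ()

tail0 : List ℕ → List ℕ
tail0 []       = []
tail0 (_ ∷ xs) = xs

-- A record rather than T (leq ρ μ), so that ρ and μ can be inferred from the type.
record _≼_ (ρ μ : List ℕ) : Set where
  constructor ≼⁺
  field ≼⁻ : T (leq ρ μ)

≼-∷ : ∀ {x xs} c → (x ∷ xs) ≼ c ⇔ (x ≤ head0 c × xs ≼ tail0 c)
≼-∷ {x} {xs} c =
  mk⇔ (λ (≼⁺ t) → let x≤ , xs≼ = to T-∧ (subst T (leq-∷ c) t) in ≤ᵇ⇒≤ x _ x≤ , ≼⁺ xs≼)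
      (λ (x≤ , ≼⁺ xs≼) → ≼⁺ (subst T (sym (leq-∷ c)) (from T-∧ (≤⇒≤ᵇ x≤ , xs≼))))
  where
  leq-∷ : ∀ c → leq (x ∷ xs) c ≡ (x ≤ᵇ head0 c) ∧ leq xs (tail0 c)
  leq-∷ []      = refl
  leq-∷ (_ ∷ _) = refl

≼-refl : ∀ a → a ≼ a
≼-refl []       = ≼⁺ _
≼-refl (x ∷ xs) = from (≼-∷ (x ∷ xs)) (≤-refl , ≼-refl xs)

≼-[] : ∀ a c → a ≼ [] → a ≼ c
≼-[] []       c _    = ≼⁺ _
≼-[] (x ∷ xs) c a≼[] =
  let x≤0 , xs≼[] = to (≼-∷ []) a≼[] in from (≼-∷ c) (≤-trans x≤0 z≤n , ≼-[] xs (tail0 c) xs≼[])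

≼-trans : ∀ a b c → a ≼ b → b ≼ c → a ≼ c
≼-trans []       _        _ _   _   = ≼⁺ _
≼-trans (x ∷ xs) []       c a≼b _   = ≼-[] (x ∷ xs) c a≼b
≼-trans (x ∷ xs) (y ∷ ys) c a≼b b≼c =
  let x≤y , xs≼ys = to (≼-∷ (y ∷ ys)) a≼b
      y≤c , ys≼c  = to (≼-∷ c) b≼c
  in from (≼-∷ c) (≤-trans x≤y y≤c , ≼-trans xs ys (tail0 c) xs≼ys ys≼c)

≼⇒head0≤ : ∀ {a b} → a ≼ b → head0 a ≤ head0 b
≼⇒head0≤ {[]}    _   = z≤n
≼⇒head0≤ {_ ∷ _} {b} a≼b = proj₁ (to (≼-∷ b) a≼b)

removeFirst-≼ : ∀ {x xs} → Partition xs → head0 xs < x →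
                Partition (cons+ (pred x) xs) × cons+ (pred x) xs ≼ (x ∷ xs)
removeFirst-≼ {1}                pxs xs<1 rewrite head0<1⇒[] pxs xs<1 = [] , ≼⁺ _
removeFirst-≼ {suc (suc x)} {xs} pxs xs<x =
  cons (s≤s z≤n) (≤-pred xs<x) pxs , from (≼-∷ (suc (suc x) ∷ xs)) (n≤1+n _ , ≼-refl xs)

removals-≼ : ∀ {μ} → Partition μ → All (λ σ → Partition σ × σ ≼ μ) (removals μ)
removals-≼ []                            = []
removals-≼ (cons {x} {xs} 0<x xs≤x pxs) =
  ++⁺ (All-if _ _ (removeFirst-≼ pxs ∘ <ᵇ⇒< _ _)) (map⁺ (All-map extend (removals-≼ pxs)))
  where
  extend : ∀ {σ} → Partition σ × σ ≼ xs → Partition (x ∷ σ) × (x ∷ σ) ≼ (x ∷ xs)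
  extend (pσ , σ≼xs) =
    cons 0<x (≤-trans (≼⇒head0≤ σ≼xs) xs≤x) pσ , from (≼-∷ (x ∷ xs)) (≤-refl , σ≼xs)

growFirst : List ℕ → List ℕ
growFirst []       = 1 ∷ []
growFirst (y ∷ ys) = suc y ∷ ys

head0-growFirst : ∀ ρ → head0 (growFirst ρ) ≡ suc (head0 ρ)
head0-growFirst []      = refl
head0-growFirst (_ ∷ _) = refl

growFirst-partition : ∀ {ρ} → Partition ρ → Partition (growFirst ρ)
growFirst-partition []                = cons (s≤s z≤n) z≤n []
growFirst-partition (cons _ ys≤y pys) = cons (s≤s z≤n) (m≤n⇒m≤1+n ys≤y) pys

growFirst-removable : ∀ {ρ x xs} → Partition ρ → x ∷ xs ≡ growFirst ρ → head0 xs < x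
growFirst-removable []              refl = s≤s z≤n
growFirst-removable (cons _ ys≤y _) refl = s≤s ys≤y

growFirst⇒removeFirst : ∀ {ρ x xs} → Partition ρ → x ∷ xs ≡ growFirst ρ → cons+ (pred x) xs ≡ ρ
growFirst⇒removeFirst []                   refl = refl
growFirst⇒removeFirst (cons {suc _} _ _ _) refl = refl

removeFirst⇒growFirst : ∀ {ρ x xs} → Partition xs → head0 xs < x →
                        cons+ (pred x) xs ≡ ρ → x ∷ xs ≡ growFirst ρ
removeFirst⇒growFirst {x = 1}           pxs xs<1 refl rewrite head0<1⇒[] pxs xs<1 = refl
removeFirst⇒growFirst {x = suc (suc _)} _   _    refl = refl

-- b bounds the first part; in the recursion it is the preceding part, which keeps the
-- results partitions.
additionsBelow : ℕ → List ℕ → List (List ℕ)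
laterAdditions : List ℕ → List (List ℕ)

additionsBelow b ρ = (if head0 ρ <ᵇ b then growFirst ρ ∷ [] else []) ++ laterAdditions ρ

laterAdditions []       = []
laterAdditions (y ∷ ys) = map (y ∷_) (additionsBelow y ys)

additions : List ℕ → List (List ℕ)
additions ρ = additionsBelow (suc (head0 ρ)) ρ

additionsBelow-sum : ∀ b ρ → All (λ σ → sum σ ≡ suc (sum ρ)) (additionsBelow b ρ)
additionsBelow-sum b []       = ++⁺ (All-if _ _ (λ _ → refl)) []
additionsBelow-sum b (y ∷ ys) =
  ++⁺ (All-if _ _ (λ _ → refl))
      (map⁺ (All-map (λ sum-σ → trans (cong (y +_) sum-σ) (+-suc y (sum ys))) (additionsBelow-sum y ys)))

additionsBelow-partition : ∀ {b ρ} → Partition ρ → head0 ρ ≤ b →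
                           All (λ σ → Partition σ × head0 σ ≤ b) (additionsBelow b ρ)
additionsBelow-partition {b} {ρ} pρ ρ≤b = ++⁺ (All-if _ _ first) (later pρ ρ≤b)
  where
  first : T (head0 ρ <ᵇ b) → Partition (growFirst ρ) × head0 (growFirst ρ) ≤ b
  first ρ<b = growFirst-partition pρ , subst (_≤ b) (sym (head0-growFirst ρ)) (<ᵇ⇒< _ _ ρ<b)
  later : ∀ {ρ} → Partition ρ → head0 ρ ≤ b → All (λ σ → Partition σ × head0 σ ≤ b) (laterAdditions ρ)
  later []                    _   = []
  later (cons 0<y ys≤y pys) y≤b =
    map⁺ (All-map (λ (pσ , σ≤y) → cons 0<y σ≤y pσ , y≤b) (additionsBelow-partition pys ys≤y))

additions-valid : ∀ {ρ} → Partition ρ →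
                  All (λ σ → Partition σ × sum σ ≡ suc (sum ρ)) (additions ρ)
additions-valid {ρ} pρ =
  All-map (λ ((pσ , _) , sum-σ) → pσ , sum-σ)
          (zip (additionsBelow-partition {b = suc (head0 ρ)} pρ (n≤1+n _) ,
                additionsBelow-sum (suc (head0 ρ)) ρ))

∑-removeFirst : ∀ {x xs ρ} → Partition (x ∷ xs) → Partition ρ →
  ∑[ μ ∈ (if head0 xs <ᵇ x then cons+ (pred x) xs ∷ [] else []) ] δ μ ρ ≡ δ (x ∷ xs) (growFirst ρ)
∑-removeFirst {x} {xs} {ρ} (cons _ _ pxs) pρ = ∑-if _ _ _
  (λ xs<x → δ-cong (removeFirst⇒growFirst pxs (<ᵇ⇒< _ _ xs<x)) (growFirst⇒removeFirst pρ))
  (λ xs≮x → δ-≢ {x ∷ xs} {growFirst ρ} (xs≮x ∘ <⇒<ᵇ ∘ growFirst-removable pρ))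

∑-growFirst : ∀ {b μ ρ} → (μ ≡ growFirst ρ → head0 ρ < b) →
  ∑[ σ ∈ (if head0 ρ <ᵇ b then growFirst ρ ∷ [] else []) ] δ μ σ ≡ δ μ (growFirst ρ)
∑-growFirst {b} {μ} {ρ} allowed =
  ∑-if _ _ _ (λ _ → refl) (λ ρ≮b → δ-≢ {μ} {growFirst ρ} (ρ≮b ∘ <⇒<ᵇ ∘ allowed))

-- ρ is μ minus a corner cell iff μ is ρ plus a cell; the hypothesis lets the bound b admit
-- the one addition that could produce μ.
removals-δ-additionsBelow : ∀ {b μ ρ} → Partition μ → Partition ρ → (μ ≡ growFirst ρ → head0 ρ < b) →
  ∑[ μ′ ∈ removals μ ] δ μ′ ρ ≡ ∑[ σ ∈ additionsBelow b ρ ] δ μ σ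
removals-δ-additionsBelow {b} {[]} {ρ} [] _ _ = sym (trans
  (∑-cong (additionsBelow-sum b ρ) (λ {σ} sum-σ → δ-≢ {[]} {σ} λ { refl → 0≢1+n sum-σ }))
  (∑-zero (additionsBelow b ρ)))
removals-δ-additionsBelow {b} {μ@(x ∷ xs)} {ρ} pμ@(cons _ xs≤x pxs) pρ allowed = begin
  ∑[ μ′ ∈ removals μ ] δ μ′ ρ
    ≡⟨ ∑-++ firstRemoval (map (x ∷_) (removals xs)) _ ⟩
  ∑[ μ′ ∈ firstRemoval ] δ μ′ ρ + ∑[ μ′ ∈ map (x ∷_) (removals xs) ] δ μ′ ρ
    ≡⟨ cong₂ _+_ (∑-removeFirst pμ pρ) (trans (∑-map (x ∷_) (removals xs) _) (later pρ)) ⟩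
  δ μ (growFirst ρ) + ∑[ σ ∈ laterAdditions ρ ] δ μ σ
    ≡⟨ cong (_+ _) (sym (∑-growFirst allowed)) ⟩
  ∑[ σ ∈ firstAddition ] δ μ σ + ∑[ σ ∈ laterAdditions ρ ] δ μ σ
    ≡⟨ sym (∑-++ firstAddition (laterAdditions ρ) _) ⟩
  ∑[ σ ∈ additionsBelow b ρ ] δ μ σ ∎
  where
  open ≡-Reasoning
  firstRemoval  = if head0 xs <ᵇ x then cons+ (pred x) xs ∷ [] else []
  firstAddition = if head0 ρ <ᵇ b then growFirst ρ ∷ [] else []
  later : ∀ {ρ} → Partition ρ → ∑[ σ ∈ removals xs ] δ (x ∷ σ) ρ ≡ ∑[ σ ∈ laterAdditions ρ ] δ μ σ
  later [] = ∑-zero≗ (λ σ → δ-≢ {x ∷ σ} {[]} λ ()) (removals xs)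
  later {y ∷ ys} (cons _ _ pys) with x ≟ y
  ... | yes refl = begin
    ∑[ σ ∈ removals xs ] δ (x ∷ σ) (x ∷ ys)      ≡⟨ ∑-cong≗ (λ σ → δ-∷ x σ ys) (removals xs) ⟩
    ∑[ σ ∈ removals xs ] δ σ ys                  ≡⟨ removals-δ-additionsBelow pxs pys xs-allowed ⟩
    ∑[ σ ∈ additionsBelow x ys ] δ xs σ          ≡⟨ ∑-cong≗ (λ σ → sym (δ-∷ x xs σ)) (additionsBelow x ys) ⟩
    ∑[ σ ∈ additionsBelow x ys ] δ μ (x ∷ σ)     ≡⟨ sym (∑-map (x ∷_) (additionsBelow x ys) _) ⟩
    ∑[ σ ∈ laterAdditions (x ∷ ys) ] δ μ σ ∎
    where
    xs-allowed : xs ≡ growFirst ys → head0 ys < x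
    xs-allowed refl = subst (_≤ x) (head0-growFirst ys) xs≤x
  ... | no x≢y = trans (∑-zero≗ (λ σ → δ-≢ {x ∷ σ} (x≢y ∘ ∷-injectiveˡ)) (removals xs))
    (sym (trans (∑-map (y ∷_) (additionsBelow y ys) _)
                (∑-zero≗ (λ σ → δ-≢ {μ} {y ∷ σ} (x≢y ∘ ∷-injectiveˡ)) (additionsBelow y ys))))

chains-suc : ∀ d {μ ρ} → Partition μ → Partition ρ →
             chains (suc d) μ ρ ≡ ∑[ σ ∈ additions ρ ] chains d μ σ
chains-suc zero    pμ pρ = removals-δ-additionsBelow pμ pρ (λ _ → n<1+n _)
chains-suc (suc d) {μ} {ρ} pμ pρ = begin
  ∑[ μ′ ∈ removals μ ] chains (suc d) μ′ ρ
    ≡⟨ ∑-cong (removals-≼ pμ) (λ (pμ′ , _) → chains-suc d pμ′ pρ) ⟩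
  ∑[ μ′ ∈ removals μ ] ∑[ σ ∈ additions ρ ] chains d μ′ σ
    ≡⟨ ∑-swap (removals μ) (additions ρ) (chains d) ⟩
  ∑[ σ ∈ additions ρ ] ∑[ μ′ ∈ removals μ ] chains d μ′ σ ∎
  where open ≡-Reasoning

chains-outside : ∀ d {μ ρ} → Partition μ → ¬ ρ ≼ μ → chains d μ ρ ≡ 0
chains-outside zero    {μ} {ρ} _ ρ⋠μ = δ-≢ {μ} {ρ} (λ { refl → ρ⋠μ (≼-refl ρ) })
chains-outside (suc d) {μ} {ρ} pμ ρ⋠μ = trans
  (∑-cong (removals-≼ pμ) λ {σ} (pσ , σ≼μ) →
    chains-outside d pσ (ρ⋠μ ∘ λ ρ≼σ → ≼-trans ρ σ μ ρ≼σ σ≼μ))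
  (∑-zero (removals μ))

multMinor≡chains : ∀ {d μ ρ} → Partition μ → sum μ ∸ sum ρ ≡ d → multMinor μ ρ ≡ chains d μ ρ
multMinor≡chains {d} {μ} {ρ} pμ refl with leq ρ μ in ρ≼μ
... | true  = refl
... | false = sym (chains-outside d {μ} {ρ} pμ (λ (≼⁺ t) → subst T ρ≼μ t))

multMinor-additions : ∀ {d μ ρ} → Partition μ → Partition ρ → sum μ ∸ sum ρ ≡ suc d →
                      multMinor μ ρ ≡ ∑[ σ ∈ additions ρ ] multMinor μ σ
multMinor-additions {d} {μ} {ρ} pμ pρ gap = begin
  multMinor μ ρ                        ≡⟨ multMinor≡chains pμ gap ⟩
  chains (suc d) μ ρ                   ≡⟨ chains-suc d pμ pρ ⟩
  ∑[ σ ∈ additions ρ ] chains d μ σ    ≡⟨ ∑-cong (additions-valid pρ) (λ {σ} (_ , sum-σ) →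
                                            multMinor≡chains pμ (gap′ {σ} sum-σ)) ⟨
  ∑[ σ ∈ additions ρ ] multMinor μ σ   ∎
  where
  open ≡-Reasoning
  gap′ : ∀ {σ} → sum σ ≡ suc (sum ρ) → sum μ ∸ sum σ ≡ d
  gap′ {σ} sum-σ = begin
    sum μ ∸ sum σ          ≡⟨ cong (sum μ ∸_) sum-σ ⟩
    sum μ ∸ suc (sum ρ)    ≡⟨ pred[m∸n]≡m∸[1+n] (sum μ) (sum ρ) ⟨
    pred (sum μ ∸ sum ρ)   ≡⟨ cong pred gap ⟩
    d                      ∎

multMinor-sameSize : ∀ {μ ρ} → Partition μ → sum μ ≡ sum ρ → multMinor μ ρ ≡ δ μ ρ
multMinor-sameSize {μ} pμ same = multMinor≡chains pμ (trans (cong (sum μ ∸_) (sym same)) (n∸n≡0 (sum μ)))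

reconstructible-0 : ∀ n → MultisetReconstructible n 0
reconstructible-0 n μ ν pμ@(_ , _ , sum-μ) pν@(_ , _ , sum-ν) sameMinors = sym (δ-≡1 (begin
  δ ν μ          ≡⟨ multMinor-sameSize (isPartition⇒Partition pν) (trans sum-ν (sym sum-μ)) ⟨
  multMinor ν μ  ≡⟨ sameMinors μ pμ ⟨
  multMinor μ μ  ≡⟨ multMinor-sameSize (isPartition⇒Partition pμ) refl ⟩
  δ μ μ          ≡⟨ δ-≡ {μ} refl ⟩
  1              ∎))
  where open ≡-Reasoning

reconstructible-pred : ∀ {n k} → suc k ≤ n →
                       MultisetReconstructible n (suc k) → MultisetReconstructible n k
reconstructible-pred {n} {k} k<n reconstruct μ ν pμ pν sameMinors =
  reconstruct μ ν pμ pν sameSmallerMinors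
  where
  open ≡-Reasoning
  sameSmallerMinors : ∀ ρ → IsPartition (n ∸ suc k) ρ → multMinor μ ρ ≡ multMinor ν ρ
  sameSmallerMinors ρ pρ@(_ , _ , sum-ρ) = begin
    multMinor μ ρ                        ≡⟨ multMinor-additions (isPartition⇒Partition pμ) ρ′ (gap pμ) ⟩
    ∑[ σ ∈ additions ρ ] multMinor μ σ   ≡⟨ ∑-cong (additions-valid ρ′) (sameMinors _ ∘ minorSize) ⟩
    ∑[ σ ∈ additions ρ ] multMinor ν σ   ≡⟨ multMinor-additions (isPartition⇒Partition pν) ρ′ (gap pν) ⟨
    multMinor ν ρ                        ∎
    where
    ρ′ = isPartition⇒Partition pρ
    gap : ∀ {τ} → IsPartition n τ → sum τ ∸ sum ρ ≡ suc k
    gap (_ , _ , sum-τ) = trans (cong₂ _∸_ sum-τ sum-ρ) (m∸[m∸n]≡n k<n)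
    minorSize : ∀ {σ} → Partition σ × sum σ ≡ suc (sum ρ) → IsPartition (n ∸ k) σ
    minorSize {σ} (pσ , sum-σ) = subst (λ m → IsPartition m σ) size (Partition⇒IsPartition pσ)
      where
      size : sum σ ≡ n ∸ k
      size = trans sum-σ (trans (cong suc sum-ρ) (sym (+-∸-assoc 1 k<n)))

allBoundedLists? : ∀ {P : List ℕ → Set} → Decidable P → ∀ b L →
                   Dec (∀ l → length l ≤ L → All (_< b) l → P l)
allBoundedLists? P? b zero =
  map′ (λ P[] → λ { [] _ _ → P[] ; (_ ∷ _) () _ }) (λ P≤0 → P≤0 [] z≤n []) (P? [])
allBoundedLists? {P} P? b (suc L) =
  map′ (λ (P[] , P∷) → λ { [] _ _ → P[] ; (x ∷ l) (s≤s l≤L) (x<b ∷ l<b) → P∷ {x} x<b l l≤L l<b })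
       (λ P≤L → P≤L [] z≤n [] , λ {x} x<b l l≤L l<b → P≤L (x ∷ l) (s≤s l≤L) (x<b ∷ l<b))
       (P? [] ×-dec allUpTo? (λ x → allBoundedLists? {λ l → P (x ∷ l)} (P? ∘ (x ∷_)) b L) b)

length≤sum : ∀ {l} → All (0 <_) l → length l ≤ sum l
length≤sum []          = z≤n
length≤sum (0<x ∷ pos) = +-mono-≤ 0<x (length≤sum pos)

parts≤sum : ∀ l → All (_≤ sum l) l
parts≤sum []      = []
parts≤sum (x ∷ l) = m≤m+n x (sum l) ∷ All-map (λ y≤ → ≤-trans y≤ (m≤n+m (sum l) x)) (parts≤sum l)

isPartition? : ∀ n l → Dec (IsPartition n l)
isPartition? n l = linked? (λ a b → b ≤? a) l ×-dec all? (0 <?_) l ×-dec (sum l ≟ n)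

allPartitions? : ∀ {P : List ℕ → Set} → Decidable P → ∀ n → Dec (∀ l → IsPartition n l → P l)
allPartitions? P? n =
  map′ (λ P≤n l pl → P≤n l (short pl) (small pl) pl) (λ Pn l _ _ → Pn l)
       (allBoundedLists? (λ l → isPartition? n l →-dec P? l) (suc n) n)
  where
  short : ∀ {l} → IsPartition n l → length l ≤ n
  short (_ , pos , sum-l) = subst (_ ≤_) sum-l (length≤sum pos)
  small : ∀ {l} → IsPartition n l → All (_< suc n) l
  small {l} (_ , _ , refl) = All-map s≤s (parts≤sum l)

reconstructible? : ∀ n k → Dec (MultisetReconstructible n k)
reconstructible? n k =
  map′ (λ R μ ν pμ pν → R μ pμ ν pν) (λ R μ pμ ν pν → R μ ν pμ pν)
       (allPartitions? (λ μ → allPartitions? (λ ν → sameMinors? μ ν →-dec ≡-dec _≟_ μ ν) n) n)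
  where
  sameMinors? : ∀ μ ν → Dec (∀ ρ → IsPartition (n ∸ k) ρ → multMinor μ ρ ≡ multMinor ν ρ)
  sameMinors? μ ν = allPartitions? (λ ρ → multMinor μ ρ ≟ multMinor ν ρ) (n ∸ k)

module _ {P : ℕ → Set} {n} (P-pred : ∀ {k} → suc k ≤ n → P (suc k) → P k) where

  downwardClosed : ∀ {j k} → j ≤ n → k ≤ j → P j → P k
  downwardClosed {zero}  _   z≤n Pj = Pj
  downwardClosed {suc j} j≤n k≤j Pj with m≤n⇒m<n∨m≡n k≤j
  ... | inj₁ k<j  = downwardClosed (<⇒≤ j≤n) (≤-pred k<j) (P-pred j≤n Pj)
  ... | inj₂ refl = Pj

  threshold : Decidable P → P 0 → Σ ℕ λ g → ∀ k → k ≤ n → (P k ⇔ k ≤ g)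
  threshold P? P0 = let g , _ , spec = upTo n ≤-refl in g , spec
    where
    upTo : ∀ m → m ≤ n → Σ ℕ λ g → g ≤ m × (∀ k → k ≤ m → (P k ⇔ k ≤ g))
    upTo zero    _   = 0 , z≤n , λ { _ z≤n → mk⇔ (λ _ → z≤n) (λ _ → P0) }
    upTo (suc m) 1+m≤n with P? (suc m) | upTo m (<⇒≤ 1+m≤n)
    ... | yes P1+m | _ =
      suc m , ≤-refl , λ k k≤1+m → mk⇔ (λ _ → k≤1+m) (λ _ → downwardClosed 1+m≤n k≤1+m P1+m)
    ... | no ¬P1+m | g , g≤m , spec =
      g , m≤n⇒m≤1+n g≤m , λ k k≤1+m → spec′ k (m≤n⇒m<n∨m≡n k≤1+m)
      where
      spec′ : ∀ k → k < suc m ⊎ k ≡ suc m → (P k ⇔ k ≤ g)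
      spec′ k (inj₁ k<1+m) = spec k (≤-pred k<1+m)
      spec′ k (inj₂ refl)  =
        mk⇔ (λ P1+m → contradiction P1+m ¬P1+m) (λ 1+m≤g → contradiction (≤-trans 1+m≤g g≤m) 1+n≰n)

corollary2p5 : Σ (ℕ → ℕ) (λ G → ∀ (n k : ℕ) → k ≤ n → (MultisetReconstructible n k ⇔ k ≤ G n))
corollary2p5 = (λ n → proj₁ (reconstructionThreshold n)) , (λ n → proj₂ (reconstructionThreshold n))
  where
  reconstructionThreshold : ∀ n → Σ ℕ λ g → ∀ k → k ≤ n → (MultisetReconstructible n k ⇔ k ≤ g)
  reconstructionThreshold n = threshold reconstructible-pred (reconstructible? n) (reconstructible-0 n)
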